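{- Let $d$ be either $0$ or a positive square-free integer, $K=\mathbb{Q}(\sqrt{ -d})$, $R$ the ring of integers of $K$. Then the induced subgraph $\Gamma_{S_{tc}(R)}(M_2(R))$ is not complete, and hence $\Gamma(M_2(R))$ is not complete.
   Context: For a ring $S$ with identity, $Z(S)^\times$ is the set of nonzero (left or right) zero-divisors. The zero-divisor graph $\Gamma(S)$ has vertex set $Z(S)^\times$, with distinct vertices $v_1,v_2$ joined (by an edge $v_1\to v_2$) iff $v_1v_2=0$; completeness means every two distinct vertices are adjacent (in the underlying undirected graph, i.e. $v_1v_2=0$ or $v_2v_1=0$). $\Gamma_T(S)$ denotes the induced subgraph on a vertex subset $T$. Here $S_{tc}(R)=\{\lambda\begin{bmatrix}1&t\\t^2&t^3\end{bmatrix}:\lambda\in R\setminus\{0\},t\in R\}\cup\{\begin{bmatrix}0&0\\0&\lambda\end{bmatrix}:\lambda\in R\setminus\{0\}\}$, a subset of $Z(M_2(R))^\times$. -}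

module Defs where

open import Data.Nat as ℕ using (ℕ; zero; suc; _%_; _/_; _≡ᵇ_)
open import Data.Nat.Divisibility using (_∣_)
open import Data.Integer as ℤ using (ℤ; +_)
open import Data.Product using (_×_; _,_; Σ; ∃; ∃-syntax)
open import Data.Sum using (_⊎_)
open import Data.Bool using (if_then_else_)
open import Relation.Binary.PropositionalEquality using (_≡_; _≢_)

SquareFree : ℕ → Set
SquareFree d = ∀ m → (m ℕ.* m) ∣ d → m ≡ 1

record RingOps : Set₁ where
  field
    Carrier : Set
    0# 1#   : Carrier
    _+_ _*_ : Carrier → Carrier → Carrier
    -_      : Carrier → Carrier

  infixl 6 _+_
  infixl 7 _*_

-- The ring ℤ[ω] with ω² = t·ω − n, elements a + bω represented as (a , b).
ℤ[ω] : ℤ → ℤ → RingOps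
ℤ[ω] t n = record
  { Carrier = ℤ × ℤ
  ; 0# = (+ 0 , + 0)
  ; 1# = (+ 1 , + 0)
  ; _+_ = λ { (a , b) (c , e) → (a ℤ.+ c , b ℤ.+ e) }
  ; _*_ = λ { (a , b) (c , e) →
              (a ℤ.* c ℤ.- n ℤ.* (b ℤ.* e) , a ℤ.* e ℤ.+ b ℤ.* c ℤ.+ t ℤ.* (b ℤ.* e)) }
  ; -_ = λ { (a , b) → (ℤ.- a , ℤ.- b) }
  }

ℤ-ops : RingOps
ℤ-ops = record { Carrier = ℤ ; 0# = + 0 ; 1# = + 1 ; _+_ = ℤ._+_ ; _*_ = ℤ._*_ ; -_ = ℤ.-_ }

-- Ring of integers of K = ℚ(√-d), for d = 0 or d > 0 square-free:
--   d = 0            : K = ℚ, R = ℤ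
--   d ≡ 3 (mod 4)    : R = ℤ[ω], ω = (1 + √-d)/2, ω² = ω − (d+1)/4
--   otherwise (d > 0): R = ℤ[ω], ω = √-d,         ω² = −d
OK : ℕ → RingOps
OK zero = ℤ-ops
OK d@(suc _) =
  if (d % 4) ≡ᵇ 3 then ℤ[ω] (+ 1) (+ (suc d / 4)) else ℤ[ω] (+ 0) (+ d)

module Matrices (R : RingOps) where
  open RingOps R

  record M₂ : Set where
    constructor mat
    field
      a₁₁ a₁₂ a₂₁ a₂₂ : Carrier

  0M : M₂
  0M = mat 0# 0# 0# 0#

  _·_ : M₂ → M₂ → M₂
  mat a b c d · mat a' b' c' d' =
    mat (a * a' + b * c') (a * b' + b * d') (c * a' + d * c') (c * b' + d * d')

  scale : Carrier → M₂ → M₂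
  scale l (mat a b c d) = mat (l * a) (l * b) (l * c) (l * d)

  ZD× : M₂ → Set
  ZD× X = X ≢ 0M × ∃[ Y ] (Y ≢ 0M × ((X · Y ≡ 0M) ⊎ (Y · X ≡ 0M)))

  Stc : M₂ → Set
  Stc X =
    (∃[ l ] ∃[ t ] (l ≢ 0# × X ≡ scale l (mat 1# t (t * t) (t * (t * t)))))
    ⊎ (∃[ l ] (l ≢ 0# × X ≡ mat 0# 0# 0# l))

  -- The (underlying undirected) graph induced on the vertex set T is complete.
  CompleteOn : (M₂ → Set) → Set
  CompleteOn T = ∀ X Y → T X → T Y → X ≢ Y → (X · Y ≡ 0M) ⊎ (Y · X ≡ 0M)

{-# OPTIONS --safe #-}
-- In any ring with 1 ≠ 0, the points t = 0 and t = 1 of the twisted cubic give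
-- E₁₁ = [[1,0],[0,0]] and J = [[1,1],[1,1]] in S_tc.  Both are zero-divisors
-- (E₁₁ E₂₂ = 0 and J [[1,0],[-1,0]] = 0), yet E₁₁ J and J E₁₁ both have (1,1)
-- entry 1, so E₁₁ and J are not adjacent.  Only a handful of ring axioms are
-- involved, and each ring of integers R satisfies them.
module Submission where

open import Defs
import Algebra.Definitions
open import Data.Bool using (true; false)
open import Data.Integer using (+_)
import Data.Integer.Properties as ℤ
open import Data.Integer.Tactic.RingSolver using (solve)
open import Data.List using (_∷_; [])
open import Data.Nat as ℕ using (ℕ; zero; suc; _>_)
open import Data.Product using (_×_; _,_)
open import Data.Sum using (_⊎_; inj₁; [_,_])
open import Relation.Binary.PropositionalEquality
  using (_≡_; _≢_; refl; sym; trans; cong; cong₂; subst)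
open import Relation.Nullary using (¬_)

record NontrivialRingLaws (R : RingOps) : Set where
  open RingOps R
  open Algebra.Definitions {A = Carrier} _≡_
  field
    1≢0          : 1# ≢ 0#
    *-identityˡ  : LeftIdentity 1# _*_
    *-zeroˡ      : LeftZero 0# _*_
    +-identityʳ  : RightIdentity 0# _+_
    +-inverseʳ   : RightInverse 0# -_ _+_

module _ (R : RingOps) where
  open RingOps R
  open Matrices R

  mat-cong : ∀ {a b c d a′ b′ c′ d′} →
    a ≡ a′ → b ≡ b′ → c ≡ c′ → d ≡ d′ → mat a b c d ≡ mat a′ b′ c′ d′
  mat-cong refl refl refl refl = refl

  ¬CompleteOn-nonadjacent : ∀ {T X Y} → T X → T Y → X ≢ Y →
    ¬ ((X · Y ≡ 0M) ⊎ (Y · X ≡ 0M)) → ¬ CompleteOn T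
  ¬CompleteOn-nonadjacent TX TY X≢Y nonadjacent complete =
    nonadjacent (complete _ _ TX TY X≢Y)

module _ {R : RingOps} (laws : NontrivialRingLaws R) where
  open RingOps R
  open Matrices R
  open NontrivialRingLaws laws

  twistedCubic : Carrier → M₂
  twistedCubic t = mat 1# t (t * t) (t * (t * t))

  E₁₁ E₂₂ J E₁₁-E₂₁ : M₂
  E₁₁     = mat 1# 0# 0# 0#
  E₂₂     = mat 0# 0# 0# 1#
  J       = mat 1# 1# 1# 1#
  E₁₁-E₂₁ = mat 1# 0# (- 1#) 0#

  scale-identity : ∀ X → scale 1# X ≡ X
  scale-identity (mat a b c d) =
    mat-cong R (*-identityˡ a) (*-identityˡ b) (*-identityˡ c) (*-identityˡ d)

  twistedCubic∈Stc : ∀ t → Stc (twistedCubic t)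
  twistedCubic∈Stc t = inj₁ (1# , t , 1≢0 , sym (scale-identity (twistedCubic t)))

  twistedCubic-0 : twistedCubic 0# ≡ E₁₁
  twistedCubic-0 = mat-cong R refl refl (*-zeroˡ 0#) (*-zeroˡ (0# * 0#))

  twistedCubic-1 : twistedCubic 1# ≡ J
  twistedCubic-1 =
    mat-cong R refl refl (*-identityˡ 1#) (trans (*-identityˡ (1# * 1#)) (*-identityˡ 1#))

  E₁₁∈Stc : Stc E₁₁
  E₁₁∈Stc = subst Stc twistedCubic-0 (twistedCubic∈Stc 0#)

  J∈Stc : Stc J
  J∈Stc = subst Stc twistedCubic-1 (twistedCubic∈Stc 1#)

  a₁₁≢0⇒≢0M : ∀ {X} → M₂.a₁₁ X ≢ 0# → X ≢ 0M
  a₁₁≢0⇒≢0M a₁₁≢0 X≡0 = a₁₁≢0 (cong M₂.a₁₁ X≡0)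

  +-zeros : ∀ {x y} → x ≡ 0# → y ≡ 0# → x + y ≡ 0#
  +-zeros x≡0 y≡0 = trans (cong₂ _+_ x≡0 y≡0) (+-identityʳ 0#)

  E₁₁·E₂₂≡0 : E₁₁ · E₂₂ ≡ 0M
  E₁₁·E₂₂≡0 = mat-cong R
    (+-zeros (*-identityˡ 0#) (*-zeroˡ 0#)) (+-zeros (*-identityˡ 0#) (*-zeroˡ 1#))
    (+-zeros (*-zeroˡ 0#) (*-zeroˡ 0#))     (+-zeros (*-zeroˡ 0#) (*-zeroˡ 1#))

  J·E₁₁-E₂₁≡0 : J · E₁₁-E₂₁ ≡ 0M
  J·E₁₁-E₂₁≡0 = mat-cong R 1-1≡0 0+0≡0 1-1≡0 0+0≡0
    where
    1-1≡0 : 1# * 1# + 1# * (- 1#) ≡ 0#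
    1-1≡0 = trans (cong₂ _+_ (*-identityˡ 1#) (*-identityˡ (- 1#))) (+-inverseʳ 1#)
    0+0≡0 : 1# * 0# + 1# * 0# ≡ 0#
    0+0≡0 = +-zeros (*-identityˡ 0#) (*-identityˡ 0#)

  E₁₁∈ZD× : ZD× E₁₁
  E₁₁∈ZD× = a₁₁≢0⇒≢0M 1≢0 , E₂₂ , (λ E₂₂≡0 → 1≢0 (cong M₂.a₂₂ E₂₂≡0)) , inj₁ E₁₁·E₂₂≡0

  J∈ZD× : ZD× J
  J∈ZD× = a₁₁≢0⇒≢0M 1≢0 , E₁₁-E₂₁ , a₁₁≢0⇒≢0M 1≢0 , inj₁ J·E₁₁-E₂₁≡0

  E₁₁≢J : E₁₁ ≢ J
  E₁₁≢J E₁₁≡J = 1≢0 (sym (cong M₂.a₁₂ E₁₁≡J))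

  E₁₁·J-a₁₁ : M₂.a₁₁ (E₁₁ · J) ≡ 1#
  E₁₁·J-a₁₁ = trans (cong₂ _+_ (*-identityˡ 1#) (*-zeroˡ 1#)) (+-identityʳ 1#)

  J·E₁₁-a₁₁ : M₂.a₁₁ (J · E₁₁) ≡ 1#
  J·E₁₁-a₁₁ = trans (cong₂ _+_ (*-identityˡ 1#) (*-identityˡ 0#)) (+-identityʳ 1#)

  E₁₁-J-nonadjacent : ¬ ((E₁₁ · J ≡ 0M) ⊎ (J · E₁₁ ≡ 0M))
  E₁₁-J-nonadjacent =
    [ a₁₁≢0⇒≢0M (λ a₁₁≡0 → 1≢0 (trans (sym E₁₁·J-a₁₁) a₁₁≡0))
    , a₁₁≢0⇒≢0M (λ a₁₁≡0 → 1≢0 (trans (sym J·E₁₁-a₁₁) a₁₁≡0)) ]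

  ¬CompleteOn-Stc : ¬ CompleteOn Stc
  ¬CompleteOn-Stc = ¬CompleteOn-nonadjacent R E₁₁∈Stc J∈Stc E₁₁≢J E₁₁-J-nonadjacent

  ¬CompleteOn-ZD× : ¬ CompleteOn ZD×
  ¬CompleteOn-ZD× = ¬CompleteOn-nonadjacent R E₁₁∈ZD× J∈ZD× E₁₁≢J E₁₁-J-nonadjacent

ℤ-laws : NontrivialRingLaws ℤ-ops
ℤ-laws = record
  { 1≢0 = λ ()
  ; *-identityˡ = ℤ.*-identityˡ
  ; *-zeroˡ = ℤ.*-zeroˡ
  ; +-identityʳ = ℤ.+-identityʳ
  ; +-inverseʳ = ℤ.+-inverseʳ
  }

ℤ[ω]-laws : ∀ t n → NontrivialRingLaws (ℤ[ω] t n)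
ℤ[ω]-laws t n = record
  { 1≢0 = λ ()
  ; *-identityˡ = *-identityˡ
  ; *-zeroˡ = *-zeroˡ
  ; +-identityʳ = λ (a , b) → cong₂ _,_ (ℤ.+-identityʳ a) (ℤ.+-identityʳ b)
  ; +-inverseʳ = λ (a , b) → cong₂ _,_ (ℤ.+-inverseʳ a) (ℤ.+-inverseʳ b)
  }
  where
  open RingOps (ℤ[ω] t n)

  *-identityˡ : ∀ x → 1# * x ≡ x
  *-identityˡ (a , b) =
    cong₂ _,_ (solve (t ∷ n ∷ a ∷ b ∷ [])) (solve (t ∷ n ∷ a ∷ b ∷ []))

  *-zeroˡ : ∀ x → 0# * x ≡ 0#
  *-zeroˡ (a , b) =
    cong₂ _,_ (solve (t ∷ n ∷ a ∷ b ∷ [])) (solve (t ∷ n ∷ a ∷ b ∷ []))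

OK-laws : ∀ d → NontrivialRingLaws (OK d)
OK-laws zero = ℤ-laws
OK-laws d@(suc _) with d ℕ.% 4 ℕ.≡ᵇ 3
... | true  = ℤ[ω]-laws (+ 1) (+ (suc d ℕ./ 4))
... | false = ℤ[ω]-laws (+ 0) (+ d)

corollary3p3 : (d : ℕ) → (d ≡ 0 ⊎ (d > 0 × SquareFree d)) →
    ¬ Matrices.CompleteOn (OK d) (Matrices.Stc (OK d))
      × ¬ Matrices.CompleteOn (OK d) (Matrices.ZD× (OK d))
corollary3p3 d _ = ¬CompleteOn-Stc (OK-laws d) , ¬CompleteOn-ZD× (OK-laws d)
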